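{- Let $G\le\mathfrak{S}_n$. The linear map sending $e_{\bar S}\mapsto\overline{e_S}$ (more precisely, $e_{\bar S}$ to the dual basis functional of $\overline{e_S}$) induces isomorphisms of complexes $(\mathcal{C}(\mathbb{F}_2)^G,U)\cong \mathrm{Hom}_{\mathbb{F}_2}((\mathcal{C}(\mathbb{F}_2)_G,D),\mathbb{F}_2)$ and $(\mathcal{C}(\mathbb{F}_2)^G,D)\cong \mathrm{Hom}_{\mathbb{F}_2}((\mathcal{C}(\mathbb{F}_2)_G,U),\mathbb{F}_2)$. Set complementation, i.e. the maps $e_{\bar S}\mapsto e_{\overline{[n]\setminus S}}$ on invariants and $\overline{e_S}\mapsto\overline{e_{[n]\setminus S}}$ on coinvariants, induces isomorphisms of complexes $(\mathcal{C}(\mathbb{F}_2)^G,D)\cong(\mathcal{C}(\mathbb{F}_2)^G,U)^{\mathrm{op}}$ and $(\mathcal{C}(\mathbb{F}_2)_G,D)\cong(\mathcal{C}(\mathbb{F}_2)_G,U)^{\mathrm{op}}$.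
   Context: $G\le\mathfrak{S}_n$ acts on $[n]$ and on subsets of $[n]$; $\bar S$ denotes the $G$-orbit of $S\subseteq[n]$. Let $V$ be the $\mathbb{F}_2$-space with basis $\{e_0,e_1\}$, $\mathcal{C}(\mathbb{F}_2)=V^{\otimes n}$, with basis $e_S=e_{i_1}\otimes\cdots\otimes e_{i_n}$ ($i_j=1$ iff $j\in S$), graded by $|S|$, with $G$ permuting the $e_S$. $\mathcal{C}(\mathbb{F}_2)^G$ denotes the $G$-invariants, with basis $e_{\bar S}=\sum_{S'\in\bar S}e_{S'}$ (one per orbit), and $\mathcal{C}(\mathbb{F}_2)_G$ the $G$-coinvariants (quotient by the span of all $u-g(u)$, degree by degree), with basis the classes $\overline{e_S}$, one per orbit. $U(e_S)=\sum_{i\notin S}e_{S\cup\{i\}}$ and $D(e_S)=\sum_{j\in S}e_{S\setminus\{j\}}$ commute with $G$ and induce (co)boundary maps ($D^2=U^2=0$) on invariants and coinvariants. $\mathrm{Hom}_{\mathbb{F}_2}(-,\mathbb{F}_2)$ of a complex is the dual complex with transposed maps. For a finite cochain complex $\mathcal{C}$, $\mathcal{C}^{\mathrm{op}}$ is the complex obtained by reindexing in the opposite order and reversing all arrows. -}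

module Defs where

open import Data.Nat using (ℕ; zero; suc; _≤_; _≡ᵇ_)
open import Data.Bool using (Bool; true; false; _xor_; _∧_; not; if_then_else_)
open import Data.Fin using (Fin)
import Data.Fin as Fin
open import Data.Fin.Subset using (Subset; inside; outside; ∣_∣; ∁; _∪_; _─_; ⁅_⁆)
open import Data.Fin.Permutation using (Permutation′; _⟨$⟩ʳ_; _⟨$⟩ˡ_; id; flip; _∘ₚ_)
open import Data.Vec using (Vec; []; _∷_; tabulate; lookup)
open import Data.Product using (Σ; _×_)
open import Data.Unit using (⊤)
open import Relation.Binary.PropositionalEquality using (_≡_; _≢_)

-- F₂ = Bool with addition _xor_ and multiplication _∧_.

Σ₂ : ∀ {n} → (Fin n → Bool) → Bool
Σ₂ {zero}  f = false
Σ₂ {suc n} f = f Fin.zero xor Σ₂ (λ i → f (Fin.suc i))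

ΣSub : ∀ n → (Subset n → Bool) → Bool
ΣSub zero    f = f []
ΣSub (suc n) f = ΣSub n (λ S → f (inside ∷ S)) xor ΣSub n (λ S → f (outside ∷ S))

-- The space C(F₂) = V^{⊗n}: an element Σ_S f(S) e_S is its coefficient
-- function f.  Grading: e_S has degree |S|.

C : ℕ → Set
C n = Subset n → Bool

_⊕_ : ∀ {n} → C n → C n → C n
(f ⊕ g) S = f S xor g S

0C : ∀ {n} → C n
0C S = false

e : ∀ {n} → Subset n → C n
e S T = eqSub S T
  where
  eqSub : ∀ {m} → Subset m → Subset m → Bool
  eqSub []       []       = true
  eqSub (a ∷ as) (b ∷ bs) = not (a xor b) ∧ eqSub as bs

Supp : ∀ {n} → ℕ → C n → Set
Supp k f = ∀ S → ∣ S ∣ ≢ k → f S ≡ false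

restrict : ∀ {n} → ℕ → C n → C n
restrict k f S = if ∣ S ∣ ≡ᵇ k then f S else false

-- U(e_S) = Σ_{i∉S} e_{S∪{i}}, hence (U f)(T) = Σ_{i∈T} f(T∖{i}).
U : ∀ {n} → C n → C n
U f T = Σ₂ (λ i → lookup T i ∧ f (T ─ ⁅ i ⁆))

-- D(e_S) = Σ_{j∈S} e_{S∖{j}}, hence (D f)(T) = Σ_{j∉T} f(T∪{j}).
D : ∀ {n} → C n → C n
D f T = Σ₂ (λ j → not (lookup T j) ∧ f (T ∪ ⁅ j ⁆))

record Subgroup (n : ℕ) : Set₁ where
  field
    _∈G     : Permutation′ n → Set
    id∈     : id ∈G
    ∘∈      : ∀ {π ρ} → π ∈G → ρ ∈G → (π ∘ₚ ρ) ∈G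
    inv∈    : ∀ {π} → π ∈G → flip π ∈G
open Subgroup public

-- action on subsets: i ∈ S  ⇔  π(i) ∈ π·S
actS : ∀ {n} → Permutation′ n → Subset n → Subset n
actS π S = tabulate (λ j → lookup S (π ⟨$⟩ˡ j))

-- action on C: π·e_S = e_{π·S}, i.e. (π·f)(T) = f(π⁻¹·T)
actC : ∀ {n} → Permutation′ n → C n → C n
actC π f T = f (actS (flip π) T)

Invariant : ∀ {n} → Subgroup n → C n → Set
Invariant G f = ∀ π → (G ∈G) π → ∀ T → actC π f T ≡ f T

-- W = span_{F₂} { u - g(u) : u ∈ C, g ∈ G } (over F₂, minus = plus)
data InW {n} (G : Subgroup n) : C n → Set where
  w0    : ∀ f → (∀ S → f S ≡ false) → InW G f
  wstep : ∀ π → (G ∈G) π → (u w f : C n) → InW G w →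
          (∀ S → f S ≡ (u S xor actC π u S) xor w S) → InW G f

-- Total-space description of a graded complex of F₂-vector spaces
-- (possibly a subspace In of a carrier, with a setoid equality).

record PreCx : Set₁ where
  field
    Carrier : Set
    In      : Carrier → Set
    _≈_     : Carrier → Carrier → Set
    _+_     : Carrier → Carrier → Carrier
    d       : Carrier → Carrier
    Deg     : ℕ → Carrier → Set

InvCx : ∀ {n} → Subgroup n → (C n → C n) → PreCx
InvCx {n} G δ = record
  { Carrier = C n ; In = Invariant G ; _≈_ = λ f g → ∀ S → f S ≡ g S
  ; _+_ = _⊕_ ; d = δ ; Deg = Supp }

-- (C_G , δ) : coinvariants, as C with the equality "differ by an element of W".
-- Degree-k part: classes having a representative homogeneous of degree k.
CoinvCx : ∀ {n} → Subgroup n → (C n → C n) → PreCx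
CoinvCx {n} G δ = record
  { Carrier = C n ; In = λ _ → ⊤ ; _≈_ = λ x y → InW G (x ⊕ y)
  ; _+_ = _⊕_ ; d = δ
  ; Deg = λ k x → Σ (C n) (λ y → InW G (x ⊕ y) × Supp k y) }

-- F₂-linear functionals on C_G: additive maps C → F₂, respecting pointwise
-- equality, and vanishing on W.
Functional : ∀ {n} → Subgroup n → (C n → Bool) → Set
Functional {n} G φ =
  (∀ x y → φ (x ⊕ y) ≡ (φ x xor φ y)) ×
  (∀ x y → (∀ S → x S ≡ y S) → φ x ≡ φ y) ×
  (∀ x → InW G x → φ x ≡ false)

-- Hom_{F₂}((C_G , δ), F₂) : dual complex with transposed map φ ↦ φ ∘ δ.
-- Degree-k part: (C_G)_k^*, i.e. functionals only seeing the degree-k component.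
DualCx : ∀ {n} → Subgroup n → (C n → C n) → PreCx
DualCx {n} G δ = record
  { Carrier = C n → Bool ; In = Functional G
  ; _≈_ = λ φ ψ → ∀ x → φ x ≡ ψ x
  ; _+_ = λ φ ψ x → φ x xor ψ x
  ; d = λ φ x → φ (δ x)
  ; Deg = λ k φ → ∀ x → φ x ≡ φ (restrict k x) }

-- Φ : A → B is an isomorphism of complexes, sending degree k to degree σ k
-- (complexes concentrated in degrees 0..n).
record ChainIso (n : ℕ) (A B : PreCx) (σ : ℕ → ℕ)
                (Φ : PreCx.Carrier A → PreCx.Carrier B) : Set where
  private
    module A = PreCx A
    module B = PreCx B
  field
    Φ-In    : ∀ x → A.In x → B.In (Φ x)
    Φ-cong  : ∀ x y → A.In x → A.In y → A._≈_ x y → B._≈_ (Φ x) (Φ y)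
    Φ-hom   : ∀ x y → A.In x → A.In y → B._≈_ (Φ (A._+_ x y)) (B._+_ (Φ x) (Φ y))
    Φ-deg   : ∀ k x → k ≤ n → A.In x → A.Deg k x → B.Deg (σ k) (Φ x)
    Φ-chain : ∀ x → A.In x → B._≈_ (Φ (A.d x)) (B.d (Φ x))
    Ψ       : B.Carrier → A.Carrier
    Ψ-In    : ∀ y → B.In y → A.In (Ψ y)
    Ψ-cong  : ∀ x y → B.In x → B.In y → B._≈_ x y → A._≈_ (Ψ x) (Ψ y)
    Ψ-deg   : ∀ k y → k ≤ n → B.In y → B.Deg (σ k) y → A.Deg k (Ψ y)
    ΦΨ      : ∀ y → B.In y → B._≈_ (Φ (Ψ y)) y
    ΨΦ      : ∀ x → A.In x → A._≈_ (Ψ (Φ x)) x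

-- Linear extension of e_{S̄} ↦ (dual basis functional of the class of e_S):
-- f = Σ_O c_O e_O ↦ (x ↦ Σ_S f(S) x(S)).
pairing : ∀ {n} → C n → (C n → Bool)
pairing {n} f x = ΣSub n (λ S → f S ∧ x S)

-- complementation: e_{S̄} ↦ e_{\overline{[n]∖S}}, resp. class of e_S ↦ class of e_{[n]∖S};
-- on coefficient functions f ↦ f ∘ ∁.
compl : ∀ {n} → C n → C n
compl f S = f (∁ S)

-- The bilinear form ⟨f , x⟩ = Σ_S f(S) x(S) on C(F₂) satisfies ⟨f , e_T⟩ = f(T), makes U and D
-- adjoint (removing i from T ∋ i and adding i to S ∌ i are inverse bijections), and for
-- G-invariant f it does not distinguish u from π·u, hence vanishes on the span W of the u − π·u.
-- So f ↦ ⟨f , -⟩ maps invariants to functionals on coinvariants, with inverse φ ↦ φ ∘ e, and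
-- intertwines U with the transpose of D and D with the transpose of U.
-- Complementation commutes with the G-action, sends degree k to n − k, and turns D into U,
-- since adding j to ∁T is removing j from T.

module Submission where

open import Defs
open import Algebra.Bundles using (CommutativeMonoid; CommutativeRing)
open import Data.Bool using (Bool; true; false; _xor_; _∧_; not; T)
open import Data.Bool.Properties
  using (xor-same; xor-identityʳ; ∧-comm; ∧-assoc; ∧-distribˡ-xor; ∧-distribʳ-xor; ∧-identityʳ; ∧-zeroʳ;
         not-involutive; ∨-zeroʳ; ∨-identityʳ; xor-∧-commutativeRing; ∧-commutativeMonoid)
open import Data.Fin using (Fin; zero; suc)
open import Data.Fin.Permutation using (Permutation′; _⟨$⟩ˡ_; flip; inverseʳ)
open import Data.Fin.Subset using (Subset; inside; outside; ∣_∣; ∁; _∪_; _─_; ⁅_⁆; ⊥)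
open import Data.Fin.Subset.Properties using (∣p∣≤n; ∣∁p∣≡n∸∣p∣; p─⊥≡p; ∪-identityʳ)
open import Data.Nat using (ℕ; zero; suc; _∸_; _≡ᵇ_; _≤_)
open import Data.Nat.Properties using (≡ᵇ⇒≡; ≡⇒≡ᵇ; m∸[m∸n]≡n)
open import Data.Product using (_×_; _,_)
open import Data.Unit using (tt)
open import Data.Vec using (Vec; []; _∷_; lookup)
open import Data.Vec.Properties using (lookup∘tabulate; tabulate∘lookup; tabulate-cong; lookup-map)
open import Function using (_∘_; const)
open import Relation.Nullary using (contradiction)
open import Relation.Binary.PropositionalEquality
  using (_≡_; _≢_; _≗_; refl; sym; trans; cong; cong₂; subst; module ≡-Reasoning)

open import Algebra.Properties.CommutativeSemigroup
  (CommutativeMonoid.commutativeSemigroup (CommutativeRing.+-commutativeMonoid xor-∧-commutativeRing))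
  using () renaming (interchange to xor-interchange)
open import Algebra.Properties.CommutativeSemigroup
  (CommutativeMonoid.commutativeSemigroup ∧-commutativeMonoid)
  using () renaming (x∙yz≈y∙xz to ∧-swap)

xor≡false⇒≡ : ∀ {a b} → a xor b ≡ false → a ≡ b
xor≡false⇒≡ {true}  {true}  _ = refl
xor≡false⇒≡ {false} {false} _ = refl

true⇔true⇒≡ : ∀ {a b : Bool} → (a ≡ true → b ≡ true) → (b ≡ true → a ≡ true) → a ≡ b
true⇔true⇒≡ {true}  {true}  f g = refl
true⇔true⇒≡ {true}  {false} f g = sym (f refl)
true⇔true⇒≡ {false} {true}  f g = g refl
true⇔true⇒≡ {false} {false} f g = refl

Σ₂-cong : ∀ {n} {f g : Fin n → Bool} → f ≗ g → Σ₂ f ≡ Σ₂ g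
Σ₂-cong {zero}  p = refl
Σ₂-cong {suc n} p = cong₂ _xor_ (p zero) (Σ₂-cong (p ∘ suc))

Σ₂-distribˡ : ∀ {n} b (f : Fin n → Bool) → b ∧ Σ₂ f ≡ Σ₂ (λ i → b ∧ f i)
Σ₂-distribˡ {zero}  b f = ∧-zeroʳ b
Σ₂-distribˡ {suc n} b f =
  trans (∧-distribˡ-xor b _ _) (cong (b ∧ f zero xor_) (Σ₂-distribˡ b (f ∘ suc)))

Σ₂-distribʳ : ∀ {n} b (f : Fin n → Bool) → Σ₂ f ∧ b ≡ Σ₂ (λ i → f i ∧ b)
Σ₂-distribʳ b f =
  trans (∧-comm (Σ₂ f) b) (trans (Σ₂-distribˡ b f) (Σ₂-cong (λ i → ∧-comm b (f i))))

ΣSub-cong : ∀ n {f g : Subset n → Bool} → f ≗ g → ΣSub n f ≡ ΣSub n g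
ΣSub-cong zero    p = p []
ΣSub-cong (suc n) p = cong₂ _xor_ (ΣSub-cong n (p ∘ (inside ∷_))) (ΣSub-cong n (p ∘ (outside ∷_)))

ΣSub-false : ∀ n {f : Subset n → Bool} → f ≗ const false → ΣSub n f ≡ false
ΣSub-false zero    p = p []
ΣSub-false (suc n) p = cong₂ _xor_ (ΣSub-false n (p ∘ (inside ∷_))) (ΣSub-false n (p ∘ (outside ∷_)))

ΣSub-xor : ∀ n (f g : Subset n → Bool) → ΣSub n (λ S → f S xor g S) ≡ ΣSub n f xor ΣSub n g
ΣSub-xor zero    f g = refl
ΣSub-xor (suc n) f g =
  trans (cong₂ _xor_ (ΣSub-xor n (f ∘ (inside ∷_)) (g ∘ (inside ∷_)))
                     (ΣSub-xor n (f ∘ (outside ∷_)) (g ∘ (outside ∷_))))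
        (xor-interchange (ΣSub n (f ∘ (inside ∷_))) (ΣSub n (g ∘ (inside ∷_)))
                         (ΣSub n (f ∘ (outside ∷_))) (ΣSub n (g ∘ (outside ∷_))))

ΣSub-distribˡ : ∀ n b (f : Subset n → Bool) → b ∧ ΣSub n f ≡ ΣSub n (λ S → b ∧ f S)
ΣSub-distribˡ zero    b f = refl
ΣSub-distribˡ (suc n) b f =
  trans (∧-distribˡ-xor b _ _)
        (cong₂ _xor_ (ΣSub-distribˡ n b (f ∘ (inside ∷_))) (ΣSub-distribˡ n b (f ∘ (outside ∷_))))

ΣSub-Σ₂-comm : ∀ n {m} (h : Subset n → Fin m → Bool) →
  ΣSub n (λ S → Σ₂ (h S)) ≡ Σ₂ (λ i → ΣSub n (λ S → h S i))
ΣSub-Σ₂-comm n {zero}  h = ΣSub-false n (λ _ → refl)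
ΣSub-Σ₂-comm n {suc m} h =
  trans (ΣSub-xor n _ _) (cong (ΣSub n (λ S → h S zero) xor_) (ΣSub-Σ₂-comm n (λ S → h S ∘ suc)))

ΣSub-comm : ∀ n m (h : Subset n → Subset m → Bool) →
  ΣSub n (λ S → ΣSub m (h S)) ≡ ΣSub m (λ T → ΣSub n (λ S → h S T))
ΣSub-comm n zero    h = refl
ΣSub-comm n (suc m) h =
  trans (ΣSub-xor n _ _)
        (cong₂ _xor_ (ΣSub-comm n m (λ S → h S ∘ (inside ∷_))) (ΣSub-comm n m (λ S → h S ∘ (outside ∷_))))

e-sym : ∀ {n} (S T : Subset n) → e S T ≡ e T S
e-sym []          []          = refl
e-sym (true  ∷ S) (true  ∷ T) = e-sym S T
e-sym (true  ∷ S) (false ∷ T) = refl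
e-sym (false ∷ S) (true  ∷ T) = refl
e-sym (false ∷ S) (false ∷ T) = e-sym S T

e-refl : ∀ {n} (S : Subset n) → e S S ≡ true
e-refl []          = refl
e-refl (true  ∷ S) = e-refl S
e-refl (false ∷ S) = e-refl S

e≡true⇒≡ : ∀ {n} (S T : Subset n) → e S T ≡ true → S ≡ T
e≡true⇒≡ []          []          p = refl
e≡true⇒≡ (true  ∷ S) (true  ∷ T) p = cong (true ∷_) (e≡true⇒≡ S T p)
e≡true⇒≡ (false ∷ S) (false ∷ T) p = cong (false ∷_) (e≡true⇒≡ S T p)

ΣSub-e : ∀ n (g : Subset n → Bool) (T : Subset n) → ΣSub n (λ S → g S ∧ e S T) ≡ g T
ΣSub-e zero    g []          = ∧-identityʳ (g [])
ΣSub-e (suc n) g (true  ∷ T) =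
  trans (cong₂ _xor_ (ΣSub-e n (g ∘ (inside ∷_)) T) (ΣSub-false n (λ S → ∧-zeroʳ _))) (xor-identityʳ _)
ΣSub-e (suc n) g (false ∷ T) =
  cong₂ _xor_ (ΣSub-false n (λ S → ∧-zeroʳ _)) (ΣSub-e n (g ∘ (outside ∷_)) T)

e-transpose : ∀ {n} (σ τ : Subset n → Subset n) → (∀ X → τ (σ X) ≡ X) → (∀ T → σ (τ T) ≡ T) →
  ∀ T X → e T (σ X) ≡ e X (τ T)
e-transpose σ τ τσ στ T X = true⇔true⇒≡
  (λ p → subst (λ Z → e X Z ≡ true) (sym (trans (cong τ (e≡true⇒≡ _ _ p)) (τσ X))) (e-refl X))
  (λ p → subst (λ Z → e T Z ≡ true) (sym (trans (cong σ (e≡true⇒≡ _ _ p)) (στ T))) (e-refl T))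

ΣSub-reindex : ∀ n (σ τ : Subset n → Subset n) → (∀ X → τ (σ X) ≡ X) → (∀ T → σ (τ T) ≡ T) →
  ∀ (g : Subset n → Bool) → ΣSub n (g ∘ σ) ≡ ΣSub n g
ΣSub-reindex n σ τ τσ στ g = begin
  ΣSub n (g ∘ σ)
    ≡⟨ ΣSub-cong n (λ S → sym (ΣSub-e n g (σ S))) ⟩
  ΣSub n (λ S → ΣSub n (λ T → g T ∧ e T (σ S)))
    ≡⟨ ΣSub-comm n n _ ⟩
  ΣSub n (λ T → ΣSub n (λ S → g T ∧ e T (σ S)))
    ≡⟨ ΣSub-cong n (λ T → sym (ΣSub-distribˡ n (g T) _)) ⟩
  ΣSub n (λ T → g T ∧ ΣSub n (λ S → e T (σ S)))
    ≡⟨ ΣSub-cong n (λ T → cong (g T ∧_) (trans (ΣSub-cong n (e-transpose σ τ τσ στ T))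
                                               (ΣSub-e n (const true) (τ T)))) ⟩
  ΣSub n (λ T → g T ∧ true)
    ≡⟨ ΣSub-cong n (∧-identityʳ ∘ g) ⟩
  ΣSub n g ∎
  where open ≡-Reasoning

Vec-ext : ∀ {n} {A : Set} (xs ys : Vec A n) → (∀ i → lookup xs i ≡ lookup ys i) → xs ≡ ys
Vec-ext xs ys p = trans (sym (tabulate∘lookup xs)) (trans (tabulate-cong p) (tabulate∘lookup ys))

lookup-actS : ∀ {n} (π : Permutation′ n) S j → lookup (actS π S) j ≡ lookup S (π ⟨$⟩ˡ j)
lookup-actS π S = lookup∘tabulate _

actS-inverseʳ : ∀ {n} (π : Permutation′ n) S → actS π (actS (flip π) S) ≡ S
actS-inverseʳ π S = Vec-ext _ _ (λ j → trans (lookup-actS π (actS (flip π) S) j)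
  (trans (lookup-actS (flip π) S _) (cong (lookup S) (inverseʳ π))))

actS-inverseˡ : ∀ {n} (π : Permutation′ n) S → actS (flip π) (actS π S) ≡ S
actS-inverseˡ π = actS-inverseʳ (flip π)

actS-∁ : ∀ {n} (π : Permutation′ n) S → ∁ (actS π S) ≡ actS π (∁ S)
actS-∁ π S = Vec-ext _ _ (λ j → begin
  lookup (∁ (actS π S)) j     ≡⟨ lookup-map j not (actS π S) ⟩
  not (lookup (actS π S) j)   ≡⟨ cong not (lookup-actS π S j) ⟩
  not (lookup S (π ⟨$⟩ˡ j))   ≡⟨ sym (lookup-map _ not S) ⟩
  lookup (∁ S) (π ⟨$⟩ˡ j)     ≡⟨ sym (lookup-actS π (∁ S) j) ⟩
  lookup (actS π (∁ S)) j     ∎)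
  where open ≡-Reasoning

actC-e : ∀ {n} (π : Permutation′ n) (T : Subset n) → actC π (e T) ≗ e (actS π T)
actC-e π T X =
  trans (e-transpose (actS (flip π)) (actS π) (actS-inverseʳ π) (actS-inverseˡ π) T X) (e-sym X _)

pairing-sym : ∀ {n} (f x : C n) → pairing f x ≡ pairing x f
pairing-sym {n} f x = ΣSub-cong n (λ S → ∧-comm (f S) (x S))

pairing-cong : ∀ {n} {f g x y : C n} → f ≗ g → x ≗ y → pairing f x ≡ pairing g y
pairing-cong {n} p q = ΣSub-cong n (λ S → cong₂ _∧_ (p S) (q S))

pairing-homˡ : ∀ {n} (f g x : C n) → pairing (f ⊕ g) x ≡ pairing f x xor pairing g x
pairing-homˡ {n} f g x = trans (ΣSub-cong n (λ S → ∧-distribʳ-xor (x S) (f S) (g S))) (ΣSub-xor n _ _)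

pairing-homʳ : ∀ {n} (f x y : C n) → pairing f (x ⊕ y) ≡ pairing f x xor pairing f y
pairing-homʳ {n} f x y = trans (ΣSub-cong n (λ S → ∧-distribˡ-xor (f S) (x S) (y S))) (ΣSub-xor n _ _)

pairing-e : ∀ {n} (f : C n) (T : Subset n) → pairing f (e T) ≡ f T
pairing-e {n} f T = trans (ΣSub-cong n (λ S → cong (f S ∧_) (e-sym T S))) (ΣSub-e n f T)

pairing-actC : ∀ {n} (π : Permutation′ n) (f u : C n) → pairing f (actC π u) ≡ pairing (actC (flip π) f) u
pairing-actC {n} π f u =
  trans (ΣSub-cong n (λ S → cong (λ Z → f Z ∧ u (actS (flip π) S)) (sym (actS-inverseʳ π S))))
        (ΣSub-reindex n (actS (flip π)) (actS π) (actS-inverseʳ π) (actS-inverseˡ π) (λ S → f (actS π S) ∧ u S))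

pairing-W : ∀ {n} (G : Subgroup n) (f : C n) → Invariant G f → ∀ x → InW G x → pairing f x ≡ false
pairing-W {n} G f f-inv x (w0 .x x≗0) = ΣSub-false n (λ S → trans (cong (f S ∧_) (x≗0 S)) (∧-zeroʳ (f S)))
pairing-W {n} G f f-inv x (wstep π π∈G u w .x w∈W x≗) = begin
  pairing f x
    ≡⟨ pairing-cong (λ _ → refl) x≗ ⟩
  pairing f ((u ⊕ actC π u) ⊕ w)
    ≡⟨ pairing-homʳ f _ w ⟩
  pairing f (u ⊕ actC π u) xor pairing f w
    ≡⟨ cong₂ _xor_ (pairing-homʳ f u _) (pairing-W G f f-inv w w∈W) ⟩
  (pairing f u xor pairing f (actC π u)) xor false
    ≡⟨ cong (λ b → (pairing f u xor b) xor false) move-π ⟩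
  (pairing f u xor pairing f u) xor false
    ≡⟨ cong (_xor false) (xor-same (pairing f u)) ⟩
  false ∎
  where
  open ≡-Reasoning
  move-π : pairing f (actC π u) ≡ pairing f u
  move-π = trans (pairing-actC π f u) (pairing-cong (f-inv (flip π) (inv∈ G π∈G)) (λ _ → refl))

pairing-restrict : ∀ {n} k (f x : C n) → Supp k f → pairing f x ≡ pairing f (restrict k x)
pairing-restrict {n} k f x f-deg = ΣSub-cong n coefficient
  where
  coefficient : ∀ S → f S ∧ x S ≡ f S ∧ restrict k x S
  coefficient S with ∣ S ∣ ≡ᵇ k in eq
  ... | true  = refl
  ... | false rewrite f-deg S (λ h → subst T eq (≡⇒≡ᵇ _ _ h)) = refl

ΣSub-remove≡ΣSub-add : ∀ n (i : Fin n) (h : Subset n → Subset n → Bool) →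
  ΣSub n (λ T → lookup T i ∧ h (T ─ ⁅ i ⁆) T) ≡ ΣSub n (λ S → not (lookup S i) ∧ h S (S ∪ ⁅ i ⁆))
ΣSub-remove≡ΣSub-add (suc n) zero h = begin
  ΣSub n (λ T → h (outside ∷ (T ─ ⊥)) (inside ∷ T)) xor ΣSub n (λ _ → false)
    ≡⟨ cong₂ _xor_ (ΣSub-cong n (λ T → cong (λ Z → h (outside ∷ Z) (inside ∷ T)) (p─⊥≡p T)))
                   (ΣSub-false n (λ _ → refl)) ⟩
  ΣSub n (λ S → h (outside ∷ S) (inside ∷ S)) xor false
    ≡⟨ xor-identityʳ _ ⟩
  ΣSub n (λ S → h (outside ∷ S) (inside ∷ S))
    ≡⟨ ΣSub-cong n (λ S → cong (λ Z → h (outside ∷ S) (inside ∷ Z)) (sym (∪-identityʳ S))) ⟩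
  ΣSub n (λ S → h (outside ∷ S) (inside ∷ (S ∪ ⊥)))
    ≡⟨ cong (_xor ΣSub n (λ S → h (outside ∷ S) (inside ∷ (S ∪ ⊥))))
            (sym (ΣSub-false n (λ _ → refl))) ⟩
  ΣSub n (λ _ → false) xor ΣSub n (λ S → h (outside ∷ S) (inside ∷ (S ∪ ⊥))) ∎
  where open ≡-Reasoning
ΣSub-remove≡ΣSub-add (suc n) (suc i) h =
  cong₂ _xor_ (ΣSub-remove≡ΣSub-add n i (λ S T → h (inside ∷ S) (inside ∷ T)))
              (ΣSub-remove≡ΣSub-add n i (λ S T → h (outside ∷ S) (outside ∷ T)))

pairing-U-D : ∀ {n} (f x : C n) → pairing (U f) x ≡ pairing f (D x)
pairing-U-D {n} f x = begin
  ΣSub n (λ T → Σ₂ (λ i → lookup T i ∧ f (T ─ ⁅ i ⁆)) ∧ x T)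
    ≡⟨ ΣSub-cong n (λ T → Σ₂-distribʳ (x T) (λ i → lookup T i ∧ f (T ─ ⁅ i ⁆))) ⟩
  ΣSub n (λ T → Σ₂ (λ i → (lookup T i ∧ f (T ─ ⁅ i ⁆)) ∧ x T))
    ≡⟨ ΣSub-Σ₂-comm n (λ T i → (lookup T i ∧ f (T ─ ⁅ i ⁆)) ∧ x T) ⟩
  Σ₂ (λ i → ΣSub n (λ T → (lookup T i ∧ f (T ─ ⁅ i ⁆)) ∧ x T))
    ≡⟨ Σ₂-cong (λ i → ΣSub-cong n (λ T → ∧-assoc (lookup T i) _ _)) ⟩
  Σ₂ (λ i → ΣSub n (λ T → lookup T i ∧ (f (T ─ ⁅ i ⁆) ∧ x T)))
    ≡⟨ Σ₂-cong (λ i → ΣSub-remove≡ΣSub-add n i (λ S T → f S ∧ x T)) ⟩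
  Σ₂ (λ i → ΣSub n (λ S → not (lookup S i) ∧ (f S ∧ x (S ∪ ⁅ i ⁆))))
    ≡⟨ Σ₂-cong (λ i → ΣSub-cong n (λ S → ∧-swap (not (lookup S i)) (f S) _)) ⟩
  Σ₂ (λ i → ΣSub n (λ S → f S ∧ (not (lookup S i) ∧ x (S ∪ ⁅ i ⁆))))
    ≡⟨ sym (ΣSub-Σ₂-comm n (λ S i → f S ∧ (not (lookup S i) ∧ x (S ∪ ⁅ i ⁆)))) ⟩
  ΣSub n (λ S → Σ₂ (λ i → f S ∧ (not (lookup S i) ∧ x (S ∪ ⁅ i ⁆))))
    ≡⟨ ΣSub-cong n (λ S → sym (Σ₂-distribˡ (f S) (λ i → not (lookup S i) ∧ x (S ∪ ⁅ i ⁆)))) ⟩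
  ΣSub n (λ S → f S ∧ Σ₂ (λ i → not (lookup S i) ∧ x (S ∪ ⁅ i ⁆))) ∎
  where open ≡-Reasoning

pairing-D-U : ∀ {n} (f x : C n) → pairing (D f) x ≡ pairing f (U x)
pairing-D-U f x = trans (pairing-sym (D f) x) (trans (sym (pairing-U-D x f)) (pairing-sym (U x) f))

Additive : ∀ {n} → (C n → Bool) → Set
Additive φ = ∀ x y → φ (x ⊕ y) ≡ φ x xor φ y

additive-0C : ∀ {n} (φ : C n → Bool) → Additive φ → φ 0C ≡ false
additive-0C φ add = trans (add 0C 0C) (xor-same (φ 0C))

additive-ΣSub : ∀ {n} (φ : C n → Bool) → Additive φ →
  ∀ m (h : Subset m → C n) → φ (λ T → ΣSub m (λ S → h S T)) ≡ ΣSub m (φ ∘ h)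
additive-ΣSub φ add zero    h = refl
additive-ΣSub φ add (suc m) h =
  trans (add _ _) (cong₂ _xor_ (additive-ΣSub φ add m (h ∘ (inside ∷_)))
                               (additive-ΣSub φ add m (h ∘ (outside ∷_))))

additive-scale : ∀ {n} (φ : C n → Bool) → Additive φ → ∀ b (v : C n) → φ (λ T → b ∧ v T) ≡ b ∧ φ v
additive-scale φ add true  v = refl
additive-scale φ add false v = additive-0C φ add

pairing-expansion : ∀ {n} (φ : C n → Bool) → Additive φ → (∀ x y → x ≗ y → φ x ≡ φ y) →
  ∀ x → pairing (φ ∘ e) x ≡ φ x
pairing-expansion {n} φ add φ-ext x = begin
  ΣSub n (λ S → φ (e S) ∧ x S)              ≡⟨ ΣSub-cong n (λ S → ∧-comm (φ (e S)) (x S)) ⟩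
  ΣSub n (λ S → x S ∧ φ (e S))              ≡⟨ ΣSub-cong n (λ S → sym (additive-scale φ add (x S) (e S))) ⟩
  ΣSub n (λ S → φ (λ T → x S ∧ e S T))      ≡⟨ sym (additive-ΣSub φ add n (λ S T → x S ∧ e S T)) ⟩
  φ (λ T → ΣSub n (λ S → x S ∧ e S T))      ≡⟨ φ-ext _ x (ΣSub-e n x) ⟩
  φ x                                       ∎
  where open ≡-Reasoning

functional-actC : ∀ {n} (G : Subgroup n) {φ : C n → Bool} → Functional G φ →
  ∀ π → (G ∈G) π → ∀ u → φ (actC π u) ≡ φ u
functional-actC G (add , _ , φ-W) π π∈G u =
  sym (xor≡false⇒≡ (trans (sym (add u (actC π u))) (φ-W _ u⊕πu∈W)))
  where
  u⊕πu∈W : InW G (u ⊕ actC π u)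
  u⊕πu∈W = wstep π π∈G u 0C _ (w0 0C (λ _ → refl)) (λ S → sym (xor-identityʳ _))

restrict-e : ∀ {n} k (S : Subset n) → ∣ S ∣ ≢ k → restrict k (e S) ≗ 0C
restrict-e k S ∣S∣≢k X with ∣ X ∣ ≡ᵇ k in ∣X∣≡ᵇk | e S X in eSX
... | false | _     = refl
... | true  | false = refl
... | true  | true  = contradiction ∣S∣≡k ∣S∣≢k
  where
  ∣S∣≡k : ∣ S ∣ ≡ k
  ∣S∣≡k = trans (cong ∣_∣ (e≡true⇒≡ S X eSX)) (≡ᵇ⇒≡ _ _ (subst T (sym ∣X∣≡ᵇk) tt))

functional∘e-invariant : ∀ {n} (G : Subgroup n) {φ : C n → Bool} → Functional G φ → Invariant G (φ ∘ e)
functional∘e-invariant G φ-fun@(_ , φ-ext , _) π π∈G T =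
  trans (φ-ext _ _ (λ X → sym (actC-e (flip π) T X)))
        (functional-actC G φ-fun (flip π) (inv∈ G π∈G) (e T))

pairing-chainIso : ∀ n (G : Subgroup n) (δ δ′ : C n → C n) → (∀ f x → pairing (δ f) x ≡ pairing f (δ′ x)) →
  ChainIso n (InvCx G δ) (DualCx G δ′) (λ k → k) pairing
pairing-chainIso n G δ δ′ δ-adjoint = record
  { Φ-In    = λ f f-inv → pairing-homʳ f , (λ _ _ → pairing-cong (λ _ → refl)) , pairing-W G f f-inv
  ; Φ-cong  = λ _ _ _ _ f≗g _ → pairing-cong f≗g (λ _ → refl)
  ; Φ-hom   = λ f g _ _ → pairing-homˡ f g
  ; Φ-deg   = λ k f _ _ f-deg x → pairing-restrict k f x f-deg
  ; Φ-chain = λ f _ → δ-adjoint f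
  ; Ψ       = _∘ e
  ; Ψ-In    = λ _ → functional∘e-invariant G
  ; Ψ-cong  = λ _ _ _ _ φ≗ψ → φ≗ψ ∘ e
  ; Ψ-deg   = Ψ-deg
  ; ΦΨ      = λ { φ (add , φ-ext , _) → pairing-expansion φ add φ-ext }
  ; ΨΦ      = λ f _ → pairing-e f
  }
  where
  Ψ-deg : ∀ k φ → k ≤ n → Functional G φ → (∀ x → φ x ≡ φ (restrict k x)) → Supp k (φ ∘ e)
  Ψ-deg k φ _ (add , φ-ext , _) φ-deg S ∣S∣≢k =
    trans (φ-deg (e S)) (trans (φ-ext _ 0C (restrict-e k S ∣S∣≢k)) (additive-0C φ add))

∁-involutive : ∀ {n} (S : Subset n) → ∁ (∁ S) ≡ S
∁-involutive []      = refl
∁-involutive (a ∷ S) = cong₂ _∷_ (not-involutive a) (∁-involutive S)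

∁-─⁅⁆ : ∀ {n} (T : Subset n) (i : Fin n) → ∁ (T ─ ⁅ i ⁆) ≡ ∁ T ∪ ⁅ i ⁆
∁-─⁅⁆ (a ∷ T) zero    = cong₂ _∷_ (sym (∨-zeroʳ (not a))) (trans (cong ∁ (p─⊥≡p T)) (sym (∪-identityʳ (∁ T))))
∁-─⁅⁆ (a ∷ T) (suc i) = cong₂ _∷_ (sym (∨-identityʳ (not a))) (∁-─⁅⁆ T i)

compl-involutive : ∀ {n} (f : C n) → compl (compl f) ≗ f
compl-involutive f S = cong f (∁-involutive S)

compl-D : ∀ {n} (f : C n) → compl (D f) ≗ U (compl f)
compl-D f T = Σ₂-cong (λ j → cong₂ _∧_
  (trans (cong not (lookup-map j not T)) (not-involutive (lookup T j)))
  (cong f (sym (∁-─⁅⁆ T j))))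

compl-invariant : ∀ {n} (G : Subgroup n) {f : C n} → Invariant G f → Invariant G (compl f)
compl-invariant G {f} f-inv π π∈G T = trans (cong f (actS-∁ (flip π) T)) (f-inv π π∈G (∁ T))

compl-W : ∀ {n} (G : Subgroup n) {f : C n} → InW G f → InW G (compl f)
compl-W G (w0 _ f≗0) = w0 _ (f≗0 ∘ ∁)
compl-W G (wstep π π∈G u w _ w∈W f≗) = wstep π π∈G (compl u) (compl w) _ (compl-W G w∈W)
  (λ S → trans (f≗ (∁ S)) (cong (λ Z → (u (∁ S) xor u Z) xor w (∁ S)) (sym (actS-∁ (flip π) S))))

≗⇒InW : ∀ {n} (G : Subgroup n) {f g : C n} → f ≗ g → InW G (f ⊕ g)
≗⇒InW G {g = g} f≗g = w0 _ (λ S → trans (cong (_xor g S) (f≗g S)) (xor-same (g S)))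

Supp-compl : ∀ {n} k (f : C n) → Supp k f → Supp (n ∸ k) (compl f)
Supp-compl {n} k f f-deg S ∣S∣≢n∸k = f-deg (∁ S) (λ ∣∁S∣≡k → ∣S∣≢n∸k (begin
  ∣ S ∣             ≡⟨ sym (m∸[m∸n]≡n (∣p∣≤n S)) ⟩
  n ∸ (n ∸ ∣ S ∣)   ≡⟨ cong (n ∸_) (sym (∣∁p∣≡n∸∣p∣ S)) ⟩
  n ∸ ∣ ∁ S ∣       ≡⟨ cong (n ∸_) ∣∁S∣≡k ⟩
  n ∸ k             ∎))
  where open ≡-Reasoning

Supp-compl⁻ : ∀ {n} k (f : C n) → k ≤ n → Supp (n ∸ k) f → Supp k (compl f)
Supp-compl⁻ {n} k f k≤n f-deg = subst (λ j → Supp j (compl f)) (m∸[m∸n]≡n k≤n) (Supp-compl (n ∸ k) f f-deg)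

compl-invariantIso : ∀ n (G : Subgroup n) → ChainIso n (InvCx G D) (InvCx G U) (λ k → n ∸ k) compl
compl-invariantIso n G = record
  { Φ-In    = λ _ → compl-invariant G
  ; Φ-cong  = λ _ _ _ _ f≗g → f≗g ∘ ∁
  ; Φ-hom   = λ _ _ _ _ _ → refl
  ; Φ-deg   = λ k f _ _ → Supp-compl k f
  ; Φ-chain = λ f _ → compl-D f
  ; Ψ       = compl
  ; Ψ-In    = λ _ → compl-invariant G
  ; Ψ-cong  = λ _ _ _ _ f≗g → f≗g ∘ ∁
  ; Ψ-deg   = λ k f k≤n _ → Supp-compl⁻ k f k≤n
  ; ΦΨ      = λ f _ → compl-involutive f
  ; ΨΦ      = λ f _ → compl-involutive f
  }

compl-coinvariantIso : ∀ n (G : Subgroup n) → ChainIso n (CoinvCx G D) (CoinvCx G U) (λ k → n ∸ k) compl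
compl-coinvariantIso n G = record
  { Φ-In    = λ _ _ → tt
  ; Φ-cong  = λ _ _ _ _ → compl-W G
  ; Φ-hom   = λ x y _ _ → ≗⇒InW G {compl (x ⊕ y)} (λ _ → refl)
  ; Φ-deg   = λ { k _ _ _ (y , x⊕y∈W , y-deg) → compl y , compl-W G x⊕y∈W , Supp-compl k y y-deg }
  ; Φ-chain = λ x _ → ≗⇒InW G (compl-D x)
  ; Ψ       = compl
  ; Ψ-In    = λ _ _ → tt
  ; Ψ-cong  = λ _ _ _ _ → compl-W G
  ; Ψ-deg   = λ { k _ k≤n _ (y , x⊕y∈W , y-deg) → compl y , compl-W G x⊕y∈W , Supp-compl⁻ k y k≤n y-deg }
  ; ΦΨ      = λ y _ → ≗⇒InW G (compl-involutive y)
  ; ΨΦ      = λ x _ → ≗⇒InW G (compl-involutive x)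
  }

proposition2p4 : (n : ℕ) (G : Subgroup n) →
    ChainIso n (InvCx G U) (DualCx G D) (λ k → k) pairing ×
    ChainIso n (InvCx G D) (DualCx G U) (λ k → k) pairing ×
    ChainIso n (InvCx G D) (InvCx G U) (λ k → n ∸ k) compl ×
    ChainIso n (CoinvCx G D) (CoinvCx G U) (λ k → n ∸ k) compl ×
    (∀ (f : C n) (T : Subset n) → pairing f (e T) ≡ f T)
proposition2p4 n G =
  pairing-chainIso n G U D pairing-U-D ,
  pairing-chainIso n G D U pairing-D-U ,
  compl-invariantIso n G ,
  compl-coinvariantIso n G ,
  pairing-e
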